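{- Let $K_{1,n}$ be the star with $n\geq 3$ leaves and let $p\geq 2$ be an integer. Then $C_{p,1}^T(K_{1,n})\leq n+2p-1$.
   Context: Labels are natural numbers. For an integer $p$, a $(p,1)$-total labelling of a graph $G$ is a function $c$ from $V(G)\cup E(G)$ to the natural numbers such that $c(u)\neq c(v)$ whenever $uv\in E(G)$, $c(e)\neq c(e')$ whenever $e,e'$ are distinct edges sharing an endpoint, and $|c(u)-c(e)|\geq p$ whenever the vertex $u$ is an endpoint of the edge $e$. A list assignment $L$ assigns to each $x\in V(G)\cup E(G)$ a finite set $L(x)$ of natural numbers; it is a $k$-assignment if $|L(x)|=k$ for all $x$. The $(p,1)$-total labelling choosability $C_{p,1}^T(G)$ is the minimum $k$ such that for every $k$-assignment $L$, $G$ has a $(p,1)$-total labelling $c$ with $c(x)\in L(x)$ for all $x\in V(G)\cup E(G)$. -}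

module Defs where

open import Data.Nat using (ℕ; _≤_; ∣_-_∣)
open import Data.Fin using (Fin)
open import Data.Product using (_×_; _,_; proj₁; proj₂; Σ)
open import Data.Sum using (_⊎_; inj₁; inj₂)
open import Data.List using (List; length)
open import Data.List.Membership.Propositional using (_∈_)
open import Data.List.Relation.Unary.Unique.Propositional using (Unique)
open import Relation.Binary.PropositionalEquality using (_≡_)
open import Relation.Nullary using (¬_)

record Graph : Set₁ where
  field
    V    : Set
    E    : Set
    ends : E → V × V

open Graph public

Elem : Graph → Set
Elem G = V G ⊎ E G

Incident : (G : Graph) → V G → E G → Set
Incident G u e = (proj₁ (ends G e) ≡ u) ⊎ (proj₂ (ends G e) ≡ u)

record IsTotalLabelling (p : ℕ) (G : Graph) (c : Elem G → ℕ) : Set where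
  field
    adjVertices : ∀ (e : E G) →
      ¬ (c (inj₁ (proj₁ (ends G e))) ≡ c (inj₁ (proj₂ (ends G e))))
    adjEdges : ∀ (e e' : E G) → ¬ (e ≡ e') →
      (Σ (V G) λ u → Incident G u e × Incident G u e') →
      ¬ (c (inj₂ e) ≡ c (inj₂ e'))
    distance : ∀ (u : V G) (e : E G) → Incident G u e →
      p ≤ ∣ c (inj₁ u) - c (inj₂ e) ∣

-- L is a k-assignment: each L(x) is a finite set (duplicate-free list)
-- of exactly k natural numbers.
IsAssignment : (G : Graph) → ℕ → (Elem G → List ℕ) → Set
IsAssignment G k L = ∀ x → Unique (L x) × length (L x) ≡ k

Choosable : ℕ → Graph → ℕ → Set
Choosable p G k = ∀ (L : Elem G → List ℕ) → IsAssignment G k L →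
  Σ (Elem G → ℕ) λ c → IsTotalLabelling p G c × (∀ x → c x ∈ L x)

data StarV (n : ℕ) : Set where
  centre : StarV n
  leaf   : Fin n → StarV n

Star : ℕ → Graph
Star n = record { V = StarV n ; E = Fin n ; ends = λ i → (centre , leaf i) }

-- C^T_{p,1}(G) ≤ m : the minimum k for which G is choosable is at most m,
-- i.e. some k ≤ m is choosable.
ChoosabilityAtMost : ℕ → Graph → ℕ → Set
ChoosabilityAtMost p G m = Σ ℕ λ k → k ≤ m × Choosable p G k

-- Colour greedily. The centre takes any colour x. An edge must avoid the
-- 2p − 1 numbers at distance < p from x and the colours of the edges already
-- coloured, at most n − 1 + 2p − 1 values in all, so a list of n + 2p − 1
-- colours always has a free one. A leaf must avoid x and the 2p − 1 numbers
-- near its edge colour, 2p values, which is fewer than n + 2p − 1 once n ≥ 2.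
module Submission where

open import Defs
open import Data.Nat using (ℕ; zero; suc; _≤_; _<_; _+_; _*_; _∸_; ∣_-_∣; z≤n; s≤s; s≤s⁻¹)
open import Data.Nat.Properties
open import Data.Fin using (Fin) renaming (zero to fzero; suc to fsuc)
open import Data.Product using (_×_; _,_; proj₁; proj₂; Σ; ∃-syntax)
open import Data.Sum using (inj₁; inj₂)
open import Data.List using (List; []; _∷_; length; applyUpTo)
open import Data.List.Properties using (length-applyUpTo; length-removeAt′)
open import Data.List.Membership.Propositional using (_∈_; _∉_; _─_)
open import Data.List.Membership.Propositional.Properties using (∈-applyUpTo⁺)
open import Data.List.Relation.Unary.Any using (here; there; index)
open import Data.List.Relation.Unary.All as All using ()
open import Data.List.Relation.Unary.Unique.Propositional using (Unique)
open import Data.List.Relation.Unary.AllPairs using (_∷_)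
open import Data.Empty using (⊥-elim)
open import Function.Definitions using (Injective)
open import Relation.Binary.Definitions using (DecidableEquality)
open import Relation.Binary.PropositionalEquality
open import Relation.Nullary using (yes; no; contradiction)

module _ {A : Set} (_≟_ : DecidableEquality A) where

  open import Data.List.Membership.DecPropositional _≟_ using (_∈?_)

  ∈-─⁺ : ∀ {x y} {ws : List A} (x∈ws : x ∈ ws) → y ∈ ws → y ≢ x → y ∈ ws ─ x∈ws
  ∈-─⁺ (here refl)   (here refl)   y≢x = contradiction refl y≢x
  ∈-─⁺ (here refl)   (there y∈ws)  _   = y∈ws
  ∈-─⁺ (there _)     (here y≡w)    _   = here y≡w
  ∈-─⁺ (there x∈ws)  (there y∈ws)  y≢x = there (∈-─⁺ x∈ws y∈ws y≢x)

  ∃-∈-∉ : ∀ {xs : List A} (ws : List A) → Unique xs → length ws < length xs →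
          ∃[ y ] y ∈ xs × y ∉ ws
  ∃-∈-∉ {x ∷ xs} ws (x∉xs ∷ xs-unique) ws<xs with x ∈? ws
  ... | no x∉ws = x , here refl , x∉ws
  ... | yes x∈ws with ∃-∈-∉ (ws ─ x∈ws) xs-unique shorter
    where
    shorter : length (ws ─ x∈ws) < length xs
    shorter = s≤s⁻¹ (subst (_< suc (length xs)) (length-removeAt′ ws (index x∈ws)) ws<xs)
  ... | y , y∈xs , y∉ws─x = y , there y∈xs , λ y∈ws →
          y∉ws─x (∈-─⁺ x∈ws y∈ws (λ y≡x → All.lookup x∉xs y∈xs (sym y≡x)))

  -- Choosing the representatives one at a time, each new list must avoid ws
  -- and the at most m − 1 representatives chosen before it.
  distinct-representatives :
    ∀ m (As : Fin m → List A) (ws : List A) →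
    (∀ i → Unique (As i)) → (∀ i → m + length ws ≤ length (As i)) →
    Σ (Fin m → A) λ f → Injective _≡_ _≡_ f × (∀ i → f i ∈ As i) × (∀ i → f i ∉ ws)
  distinct-representatives zero _ _ _ _ = (λ ()) , (λ { {()} }) , (λ ()) , (λ ())
  distinct-representatives (suc m) As ws unique long
    with ∃-∈-∉ ws (unique fzero) (≤-trans (s≤s (m≤n+m (length ws) m)) (long fzero))
  ... | y , y∈A₀ , y∉ws
    with distinct-representatives m (λ i → As (fsuc i)) (y ∷ ws) (λ i → unique (fsuc i))
           (λ i → subst (_≤ length (As (fsuc i))) (sym (+-suc m (length ws))) (long (fsuc i)))
  ... | g , g-injective , g∈As , g∉y∷ws = f , f-injective , f∈As , f∉ws
    where
    f : Fin (suc m) → A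
    f fzero    = y
    f (fsuc i) = g i

    f-injective : Injective _≡_ _≡_ f
    f-injective {fzero}  {fzero}  _   = refl
    f-injective {fzero}  {fsuc j} y≡g = ⊥-elim (g∉y∷ws j (here (sym y≡g)))
    f-injective {fsuc i} {fzero}  g≡y = ⊥-elim (g∉y∷ws i (here g≡y))
    f-injective {fsuc i} {fsuc j} g≡g = cong fsuc (g-injective g≡g)

    f∈As : ∀ i → f i ∈ As i
    f∈As fzero    = y∈A₀
    f∈As (fsuc i) = g∈As i

    f∉ws : ∀ i → f i ∉ ws
    f∉ws fzero    = y∉ws
    f∉ws (fsuc i) y∈ws = g∉y∷ws i (there y∈ws)

∣m-n∣≤o⇒m≤n+o : ∀ {m n o} → ∣ m - n ∣ ≤ o → m ≤ n + o
∣m-n∣≤o⇒m≤n+o {zero}          _  = z≤n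
∣m-n∣≤o⇒m≤n+o {suc m} {zero}  le = le
∣m-n∣≤o⇒m≤n+o {suc m} {suc n} le = s≤s (∣m-n∣≤o⇒m≤n+o {m} {n} le)

-- For x < q truncated subtraction repeats 0; only membership matters.
window : ℕ → ℕ → List ℕ
window x q = applyUpTo (λ j → x + j ∸ q) (suc (q + q))

length-window : ∀ x q → length (window x q) ≡ suc (q + q)
length-window x q = length-applyUpTo (λ j → x + j ∸ q) (suc (q + q))

∈-window : ∀ {x y q} → ∣ x - y ∣ ≤ q → y ∈ window x q
∈-window {x} {y} {q} close =
  subst (_∈ window x q) value (∈-applyUpTo⁺ (λ j → x + j ∸ q) (s≤s j≤q+q))
  where
  x≤y+q : x ≤ y + q
  x≤y+q = ∣m-n∣≤o⇒m≤n+o close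

  y≤x+q : y ≤ x + q
  y≤x+q = ∣m-n∣≤o⇒m≤n+o (subst (_≤ q) (∣-∣-comm x y) close)

  j≤q+q : y + q ∸ x ≤ q + q
  j≤q+q = m≤n+o⇒m∸n≤o (y + q) x
            (subst (y + q ≤_) (+-assoc x q q) (+-monoˡ-≤ q y≤x+q))

  value : x + (y + q ∸ x) ∸ q ≡ y
  value = begin
    x + (y + q ∸ x) ∸ q ≡⟨ cong (_∸ q) (m+[n∸m]≡n x≤y+q) ⟩
    y + q ∸ q           ≡⟨ m+n∸n≡m y q ⟩
    y                   ∎
    where open ≡-Reasoning

∉-window⇒far : ∀ {x y q} → y ∉ window x q → suc q ≤ ∣ x - y ∣
∉-window⇒far y∉window = ≰⇒> (λ close → y∉window (∈-window close))

starLabel : ∀ {n} → ℕ → (Fin n → ℕ) → (Fin n → ℕ) → Elem (Star n) → ℕ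
starLabel x f h (inj₁ centre)   = x
starLabel x f h (inj₁ (leaf i)) = h i
starLabel x f h (inj₂ i)        = f i

starLabel-isTotalLabelling :
  ∀ {p n} x (f h : Fin n → ℕ) → Injective _≡_ _≡_ f →
  (∀ i → p ≤ ∣ x - f i ∣) → (∀ i → h i ≢ x) → (∀ i → p ≤ ∣ h i - f i ∣) →
  IsTotalLabelling p (Star n) (starLabel x f h)
starLabel-isTotalLabelling {p} {n} x f h f-injective centre-far leaf≢centre leaf-far =
  record
    { adjVertices = λ i x≡h → leaf≢centre i (sym x≡h)
    ; adjEdges    = λ i j i≢j _ f≡f → i≢j (f-injective f≡f)
    ; distance    = distance
    }
  where
  distance : ∀ u i → Incident (Star n) u i → p ≤ ∣ starLabel x f h (inj₁ u) - f i ∣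
  distance centre   i _          = centre-far i
  distance (leaf j) i (inj₁ ())
  distance (leaf j) i (inj₂ refl) = leaf-far i

star-choosable : ∀ {n q k} → 2 ≤ n → n + suc (q + q) ≤ k → Choosable (suc q) (Star n) k
star-choosable {n} {q} {k} 2≤n enough L assignment =
  starLabel x f h ,
  starLabel-isTotalLabelling x f h f-injective
    (λ i → ∉-window⇒far (f∉window i))
    (λ i x≡h → h∉ i (here x≡h))
    (λ i → subst (suc q ≤_) (∣-∣-comm (f i) (h i)) (∉-window⇒far (λ w → h∉ i (there w)))) ,
  λ { (inj₁ centre) → x∈ ; (inj₁ (leaf i)) → h∈ i ; (inj₂ i) → f∈ i }
  where
  unique : ∀ e → Unique (L e)
  unique e = proj₁ (assignment e)

  enough′ : ∀ e → n + suc (q + q) ≤ length (L e)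
  enough′ e = subst (n + suc (q + q) ≤_) (sym (proj₂ (assignment e))) enough

  centre-colour : ∃[ y ] y ∈ L (inj₁ centre) × y ∉ []
  centre-colour = ∃-∈-∉ _≟_ [] (unique (inj₁ centre))
                    (≤-trans (≤-trans (s≤s z≤n) (m≤n+m (suc (q + q)) n)) (enough′ (inj₁ centre)))

  x : ℕ
  x = proj₁ centre-colour

  x∈ : x ∈ L (inj₁ centre)
  x∈ = proj₁ (proj₂ centre-colour)

  edge-colours : Σ (Fin n → ℕ) λ f → Injective _≡_ _≡_ f ×
                   (∀ i → f i ∈ L (inj₂ i)) × (∀ i → f i ∉ window x q)
  edge-colours = distinct-representatives _≟_ n (λ i → L (inj₂ i)) (window x q)
                   (λ i → unique (inj₂ i))
                   (λ i → subst (λ t → n + t ≤ length (L (inj₂ i)))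
                            (sym (length-window x q)) (enough′ (inj₂ i)))

  f : Fin n → ℕ
  f = proj₁ edge-colours

  f-injective : Injective _≡_ _≡_ f
  f-injective = proj₁ (proj₂ edge-colours)

  f∈ : ∀ i → f i ∈ L (inj₂ i)
  f∈ = proj₁ (proj₂ (proj₂ edge-colours))

  f∉window : ∀ i → f i ∉ window x q
  f∉window = proj₂ (proj₂ (proj₂ edge-colours))

  leaf-colour : ∀ i → ∃[ y ] y ∈ L (inj₁ (leaf i)) × y ∉ x ∷ window (f i) q
  leaf-colour i = ∃-∈-∉ _≟_ (x ∷ window (f i) q) (unique (inj₁ (leaf i)))
    (subst (λ t → suc t < length (L (inj₁ (leaf i)))) (sym (length-window (f i) q))
      (≤-trans (+-monoˡ-≤ (suc (q + q)) 2≤n) (enough′ (inj₁ (leaf i)))))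

  h : Fin n → ℕ
  h i = proj₁ (leaf-colour i)

  h∈ : ∀ i → h i ∈ L (inj₁ (leaf i))
  h∈ i = proj₁ (proj₂ (leaf-colour i))

  h∉ : ∀ i → h i ∉ x ∷ window (f i) q
  h∉ i = proj₂ (proj₂ (leaf-colour i))

theorem3p1 : ∀ (n p : ℕ) → 3 ≤ n → 2 ≤ p →
    ChoosabilityAtMost p (Star n) (n + 2 * p ∸ 1)
-- The argument only needs n ≥ 2 and p ≥ 1.
theorem3p1 n (suc q) 3≤n _ =
  n + 2 * suc q ∸ 1 , ≤-refl , star-choosable (≤-trans (n≤1+n 2) 3≤n) (≤-reflexive bound)
  where
  bound : n + suc (q + q) ≡ n + 2 * suc q ∸ 1
  bound = begin
    n + suc (q + q)                 ≡⟨ cong (λ t → n + suc (q + t)) (sym (+-identityʳ q)) ⟩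
    n + suc (q + (q + 0))           ≡⟨ cong (n +_) (sym (+-suc q (q + 0))) ⟩
    suc (n + (q + suc (q + 0))) ∸ 1 ≡⟨ cong (_∸ 1) (sym (+-suc n (q + suc (q + 0)))) ⟩
    n + 2 * suc q ∸ 1               ∎
    where open ≡-Reasoning
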